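{- Let $G$ be a connected graph and $g\ge 0$ an integer. If $\kappa^g(G)$ exists and there is a $g$-good-neighbor cut $X$ with $|X|=\kappa^g(G)$ such that $c(X)=g+1$ or $a(X)=g+1$, then $c^g(G)=\kappa^g(G)+g+1$.
   Context: For a graph $G=(V,E)$, a set $X\subseteq V$ is a $g$-good-neighbor cut if $G-X$ is disconnected and every vertex of $V\setminus X$ has at least $g$ neighbors in $V\setminus X$; $\kappa^g(G)$ is the minimum size of such a cut, and it exists if such a cut exists. For a $g$-good-neighbor cut $X$ and a component $C$ of $G-X$, call $C$ splittable if $V(C)$ can be partitioned into two nonempty sets $A,B$ with $\delta(G[A])\ge g$ and $\delta(G[B])\ge g$; among such partitions with $|A|\ge|B|$ take one minimizing $|A|-|B|$ and set $a(C)=|A|$. Let $a(X)$ be the minimum of $a(C)$ over splittable components of $G-X$, and $c(X)$ the minimum order of a non-splittable component of $G-X$ (minima over the empty set are $+\infty$). The gc number is $c^g(G)=\min_X\{|X|+\min\{a(X),c(X)\}\}$ over all $g$-good-neighbor cuts $X$. -}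

module Defs where

open import Data.Nat using (ℕ; _≤_; _+_; _∸_; suc)
open import Data.Bool using (Bool; true; false)
open import Data.Fin using (Fin)
open import Data.Fin.Subset using (Subset; _∈_; _∉_; _⊆_; ∁; _∩_; ∣_∣; Nonempty)
open import Data.Vec using (tabulate)
open import Data.Product using (Σ; ∃; _×_; _,_)
open import Data.Sum using (_⊎_)
open import Data.Empty using (⊥)
open import Relation.Nullary using (¬_)
open import Relation.Binary.PropositionalEquality using (_≡_)

record Graph : Set where
  field
    n      : ℕ
    adj    : Fin n → Fin n → Bool
    sym    : ∀ u v → adj u v ≡ adj v u
    irrefl : ∀ v → adj v v ≡ false
open Graph public

module _ (G : Graph) where
  V : Set
  V = Fin (n G)

  VSet : Set
  VSet = Subset (n G)

  N : V → VSet
  N v = tabulate (adj G v)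

  degIn : VSet → V → ℕ
  degIn S v = ∣ N v ∩ S ∣

  MinDegGe : VSet → ℕ → Set
  MinDegGe S g = ∀ v → v ∈ S → g ≤ degIn S v

  data Reach (S : VSet) : V → V → Set where
    here : ∀ {u} → u ∈ S → Reach S u u
    step : ∀ {u w v} → u ∈ S → adj G u w ≡ true → Reach S w v → Reach S u v

  Connected : Set
  Connected = ∀ u v → Reach (Data.Fin.Subset.⊤) u v

  DisconnectedMinus : VSet → Set
  DisconnectedMinus X = Σ V λ u → Σ V λ v → u ∈ ∁ X × v ∈ ∁ X × ¬ Reach (∁ X) u v

  GoodCut : ℕ → VSet → Set
  GoodCut g X = DisconnectedMinus X × MinDegGe (∁ X) g

  IsComponent : VSet → VSet → Set
  IsComponent X C =
    C ⊆ ∁ X × Nonempty C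
    × (∀ u v → u ∈ C → v ∈ C → Reach C u v)
    × (∀ u v → u ∈ C → v ∈ ∁ X → adj G u v ≡ true → v ∈ C)

  GoodPartition : ℕ → VSet → VSet → VSet → Set
  GoodPartition g C A B =
    A ⊆ C × B ⊆ C × (∀ v → v ∈ C → v ∈ A ⊎ v ∈ B) × (∀ v → v ∈ A → v ∈ B → ⊥)
    × Nonempty A × Nonempty B × MinDegGe A g × MinDegGe B g

  Splittable : ℕ → VSet → Set
  Splittable g C = Σ VSet λ A → Σ VSet λ B → GoodPartition g C A B

  -- a(C) = k : some good partition with |A| ≥ |B| minimising |A| - |B| has |A| = k
  AValue : ℕ → VSet → ℕ → Set
  AValue g C k = Σ VSet λ A → Σ VSet λ B →
    GoodPartition g C A B × ∣ B ∣ ≤ ∣ A ∣ × ∣ A ∣ ≡ k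
    × (∀ A' B' → GoodPartition g C A' B' → ∣ B' ∣ ≤ ∣ A' ∣ →
         ∣ A ∣ ∸ ∣ B ∣ ≤ ∣ A' ∣ ∸ ∣ B' ∣)

  -- a(X) = k (as a finite value): minimum of a(C) over splittable components
  AOfCut : ℕ → VSet → ℕ → Set
  AOfCut g X k =
    (Σ VSet λ C → IsComponent X C × AValue g C k)
    × (∀ C k' → IsComponent X C → AValue g C k' → k ≤ k')

  -- c(X) = k (as a finite value): minimum order of a non-splittable component
  COfCut : ℕ → VSet → ℕ → Set
  COfCut g X k =
    (Σ VSet λ C → IsComponent X C × ¬ Splittable g C × ∣ C ∣ ≡ k)
    × (∀ C → IsComponent X C → ¬ Splittable g C → k ≤ ∣ C ∣)

  IsKappa : ℕ → ℕ → Set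
  IsKappa g k =
    (Σ VSet λ X → GoodCut g X × ∣ X ∣ ≡ k)
    × (∀ X → GoodCut g X → k ≤ ∣ X ∣)

  -- contribution of component C of G - X to min{a(X), c(X)}:
  -- a(C) if C is splittable, |C| otherwise
  CompVal : ℕ → VSet → VSet → ℕ → Set
  CompVal g X C k = IsComponent X C × (AValue g C k ⊎ (¬ Splittable g C × ∣ C ∣ ≡ k))

  -- c^g(G) = m, i.e. m = min over g-good-neighbor cuts X of |X| + min{a(X), c(X)}
  IsGcNumber : ℕ → ℕ → Set
  IsGcNumber g m =
    (Σ VSet λ X → GoodCut g X × Σ VSet λ C → Σ ℕ λ k → CompVal g X C k × ∣ X ∣ + k ≡ m)
    × (∀ X C k → GoodCut g X → CompVal g X C k → m ≤ ∣ X ∣ + k)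

-- A vertex set S with δ(G[S]) ≥ g has at least g + 1 vertices: any vertex of S and its
-- at least g neighbours inside S are distinct. Every component of G − X' for a g-good-neighbor
-- cut X' induces minimum degree ≥ g, and so does the part A of any good partition, hence every
-- candidate |X'| + a(C) or |X'| + |C| is at least κ^g(G) + g + 1; the given cut X attains it.
module Submission where

open import Defs hiding (sym)
open import Data.Nat using (ℕ; suc; _+_; _≤_; _<_)
open import Data.Nat.Properties using (≤-trans; ≤-<-trans; ≤-reflexive; +-mono-≤)
open import Data.Fin.Subset using (∣_∣; _∈_; _∉_; _∩_; _⊆_; ∁; Nonempty)
open import Data.Fin.Subset.Properties
  using (p⊂q⇒∣p∣<∣q∣; p⊆q⇒∣p∣≤∣q∣; p∩q⊆p; p∩q⊆q; x∈p∩q⁺; x∈p∩q⁻)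
open import Data.Vec.Properties using ([]=⇒lookup; lookup∘tabulate)
open import Data.Bool using (true)
open import Data.Sum using (_⊎_; inj₁; inj₂)
open import Data.Product using (∃; _,_)
open import Function using (_∘_)
open import Relation.Binary.PropositionalEquality using (_≡_; trans; sym; cong)

module _ (G : Graph) where

  ∈N⇒adj : ∀ {v w} → w ∈ N G v → adj G v w ≡ true
  ∈N⇒adj {v} {w} w∈N = trans (sym (lookup∘tabulate (adj G v) w)) ([]=⇒lookup w∈N)

  v∉N[v] : ∀ v → v ∉ N G v
  v∉N[v] v v∈N with trans (sym (∈N⇒adj v∈N)) (irrefl G v)
  ... | ()

  degIn<∣S∣ : ∀ {S v} → v ∈ S → degIn G S v < ∣ S ∣
  degIn<∣S∣ {S} {v} v∈S =
    p⊂q⇒∣p∣<∣q∣ (p∩q⊆q (N G v) S , v , v∈S , v∉N[v] v ∘ p∩q⊆p (N G v) S)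

  minDegGe⇒suc≤∣S∣ : ∀ {S g} → MinDegGe G S g → Nonempty S → suc g ≤ ∣ S ∣
  minDegGe⇒suc≤∣S∣ δ≥g (v , v∈S) = ≤-<-trans (δ≥g v v∈S) (degIn<∣S∣ v∈S)

  component-minDegGe : ∀ {X C g} → MinDegGe G (∁ X) g → IsComponent G X C → MinDegGe G C g
  component-minDegGe {X} {C} δ≥g (C⊆∁X , _ , _ , closed) v v∈C =
    ≤-trans (δ≥g v (C⊆∁X v∈C)) (p⊆q⇒∣p∣≤∣q∣ N∩∁X⊆N∩C)
    where
    N∩∁X⊆N∩C : N G v ∩ ∁ X ⊆ N G v ∩ C
    N∩∁X⊆N∩C w∈ with x∈p∩q⁻ (N G v) (∁ X) w∈
    ... | w∈N , w∈∁X = x∈p∩q⁺ (w∈N , closed v _ v∈C w∈∁X (∈N⇒adj w∈N))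

  component-suc≤∣C∣ : ∀ {X C g} → GoodCut G g X → IsComponent G X C → suc g ≤ ∣ C ∣
  component-suc≤∣C∣ (_ , δ≥g) isComp@(_ , C≠∅ , _) =
    minDegGe⇒suc≤∣S∣ (component-minDegGe δ≥g isComp) C≠∅

  aValue-suc≤ : ∀ {g C k} → AValue G g C k → suc g ≤ k
  aValue-suc≤ (_ , _ , (_ , _ , _ , _ , A≠∅ , _ , δA≥g , _) , _ , ∣A∣≡k , _) =
    ≤-trans (minDegGe⇒suc≤∣S∣ δA≥g A≠∅) (≤-reflexive ∣A∣≡k)

  compVal-suc≤ : ∀ {g X C k} → GoodCut G g X → CompVal G g X C k → suc g ≤ k
  compVal-suc≤ _  (_ , inj₁ aC≡k) = aValue-suc≤ aC≡k
  compVal-suc≤ gc (isComp , inj₂ (_ , ∣C∣≡k)) =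
    ≤-trans (component-suc≤∣C∣ gc isComp) (≤-reflexive ∣C∣≡k)

  componentAttaining : ∀ {g X k} → COfCut G g X k ⊎ AOfCut G g X k → ∃ λ C → CompVal G g X C k
  componentAttaining (inj₁ ((C , isComp , unsplittable , ∣C∣≡k) , _)) =
    C , isComp , inj₂ (unsplittable , ∣C∣≡k)
  componentAttaining (inj₂ ((C , isComp , aC≡k) , _)) = C , isComp , inj₁ aC≡k

corollary3p2 : (G : Graph) (g : ℕ) → Connected G → (κ : ℕ) → IsKappa G g κ →
    (X : VSet G) → GoodCut G g X → ∣ X ∣ ≡ κ →
    (COfCut G g X (suc g) ⊎ AOfCut G g X (suc g)) →
    IsGcNumber G g (κ + suc g)
corollary3p2 G g _ κ (_ , κ-minimal) X gc ∣X∣≡κ cX⊎aX with componentAttaining G cX⊎aX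
... | C , val = (X , gc , C , suc g , val , cong (_+ suc g) ∣X∣≡κ)
             , λ X' _ _ gc' val' → +-mono-≤ (κ-minimal X' gc') (compVal-suc≤ G gc' val')
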